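{- Let $G$ be a finite $2$-transitive permutation group on a set $X$ with a regular normal subgroup $N$, let $x\in X$ and $H=G_x$. Then the subgroup of $G$ generated by $\mathrm{Der}_G$ is equal to the subgroup generated by $N$ together with the two-point stabilizers $H_y=G_x\cap G_y$ for $y\in X$, $y\neq x$.
   Context: $\mathrm{Der}_G$ denotes the set of derangements (elements with no fixed point on $X$) of $G$. -}

module Defs where

open import Level using (Level; suc; _⊔_)
open import Data.Nat using (ℕ)
open import Data.Fin using (Fin)
open import Data.Product using (Σ; _×_; ∃-syntax; _,_)
open import Data.Sum using (_⊎_)
open import Relation.Nullary using (¬_)
open import Relation.Binary.PropositionalEquality using (_≡_; _≢_)
open import Data.Fin.Permutation
  using (Permutation′; _⟨$⟩ʳ_; _≈_; id; flip; _∘ₚ_)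

PermSet : ℕ → Set₁
PermSet n = Permutation′ n → Set

record IsPermGroup {n : ℕ} (G : PermSet n) : Set where
  field
    resp  : ∀ {σ τ} → σ ≈ τ → G σ → G τ
    has-id : G id
    comp  : ∀ {σ τ} → G σ → G τ → G (σ ∘ₚ τ)
    inv   : ∀ {σ} → G σ → G (flip σ)

_⊆ₚ_ : ∀ {n} → PermSet n → PermSet n → Set
A ⊆ₚ B = ∀ σ → A σ → B σ

TwoTransitive : ∀ {n} → PermSet n → Set
TwoTransitive {n} G =
  ∀ (x₁ x₂ y₁ y₂ : Fin n) → x₁ ≢ x₂ → y₁ ≢ y₂ →
  ∃[ g ] (G g × g ⟨$⟩ʳ x₁ ≡ y₁ × g ⟨$⟩ʳ x₂ ≡ y₂)

IsNormalSubgroup : ∀ {n} → PermSet n → PermSet n → Set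
IsNormalSubgroup N G =
  IsPermGroup N × (N ⊆ₚ G) ×
  (∀ g ν → G g → N ν → N (flip g ∘ₚ ν ∘ₚ g))

IsRegular : ∀ {n} → PermSet n → Set
IsRegular {n} N =
  (∀ (x y : Fin n) → ∃[ ν ] (N ν × ν ⟨$⟩ʳ x ≡ y)) ×
  (∀ ν (x : Fin n) → N ν → ν ⟨$⟩ʳ x ≡ x → ν ≈ id)

Der : ∀ {n} → PermSet n → PermSet n
Der {n} G σ = G σ × (∀ (i : Fin n) → σ ⟨$⟩ʳ i ≢ i)

Stab₂ : ∀ {n} → PermSet n → Fin n → Fin n → PermSet n
Stab₂ G x y σ = G σ × σ ⟨$⟩ʳ x ≡ x × σ ⟨$⟩ʳ y ≡ y

data ⟨_⟩ {n : ℕ} (S : PermSet n) : PermSet n where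
  gen  : ∀ {σ} → S σ → ⟨ S ⟩ σ
  one  : ⟨ S ⟩ id
  mul  : ∀ {σ τ} → ⟨ S ⟩ σ → ⟨ S ⟩ τ → ⟨ S ⟩ (σ ∘ₚ τ)
  inv  : ∀ {σ} → ⟨ S ⟩ σ → ⟨ S ⟩ (flip σ)
  resp : ∀ {σ τ} → σ ≈ τ → ⟨ S ⟩ σ → ⟨ S ⟩ τ

_≐_ : ∀ {n} → PermSet n → PermSet n → Set
A ≐ B = (A ⊆ₚ B) × (B ⊆ₚ A)

module Submission where

-- Fix the base point x and, for a permutation g of X,
-- let δ g v be the unique element of the regular subgroup N sending g v back
-- to v; record it by its value  disp g v = (δ g v)(x)  (elements of N are
-- determined by the image of x).  For μ ∈ N the permutation "first g, then μ"
-- fixes v exactly when μ(x) = disp g v.  Hence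
--   * g is a derangement  ⇔ disp g misses x, and
--   * g μ is a derangement ⇔ disp g misses μ(x).
-- Since a self-map of the finite set X misses a point iff it has a collision:
--   Der_G ⊆ ⟨S⟩: disp g misses x, so it has a collision disp g i = disp g j,
--     and g (δ g i) is an element of G fixing i ≠ j; conjugating by an element
--     of N taking i to x puts it into some H_y.
--   S ⊆ ⟨Der_G⟩: an element of N is trivial or a derangement; for h ∈ H_y we
--     have disp h x = x = disp h y, so disp h misses some w, and with ν ∈ N,
--     ν(x) = w, both h ν and ν are derangements and h = (h ν) ν⁻¹.
-- Throughout, σ ∘ₚ τ means "first σ, then τ".

open import Defs
open import Data.Nat using (ℕ; suc)
open import Data.Nat.Properties using (n<1+n)
open import Data.Fin using (Fin; punchOut)
open import Data.Fin.Properties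
  using (pigeonhole; punchOut-injective; <⇒≢; any?; all?; ¬∀⟶∃¬; _≟_)
open import Data.Product using (_×_; ∃-syntax; _,_; proj₁; proj₂)
open import Data.Sum using (_⊎_; inj₁; inj₂)
open import Function.Definitions using (Injective)
open import Relation.Nullary using (¬_; yes; no; ¬?)
open import Relation.Nullary.Decidable using (decidable-stable)
open import Relation.Binary.PropositionalEquality
  using (_≡_; _≢_; refl; sym; trans; cong; subst; module ≡-Reasoning)
open import Data.Fin.Permutation
  using (Permutation′; _⟨$⟩ʳ_; _⟨$⟩ˡ_; _≈_; id; flip; _∘ₚ_; inverseˡ; inverseʳ)

-- A self-map of Fin n that misses a point is not injective (pigeonhole on
-- Fin n → Fin (n - 1), after punching out the missed point).
miss⇒collision : ∀ {n} (f : Fin n → Fin n) (w : Fin n) → (∀ v → f v ≢ w) →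
                 ∃[ i ] ∃[ j ] (i ≢ j × f i ≡ f j)
miss⇒collision {suc m} f w miss
  with pigeonhole (n<1+n m) (λ v → punchOut (λ w≡fv → miss v (sym w≡fv)))
... | i , j , i<j , eq =
  i , j , <⇒≢ i<j ,
  punchOut-injective (λ e → miss i (sym e)) (λ e → miss j (sym e)) eq

injective⇒surjective : ∀ {n} (f : Fin n → Fin n) → Injective _≡_ _≡_ f →
                       ∀ w → ∃[ v ] (f v ≡ w)
injective⇒surjective f inj w with any? (λ v → f v ≟ w)
... | yes hit = hit
... | no ¬hit with miss⇒collision f w (λ v fv≡w → ¬hit (v , fv≡w))
...   | i , j , i≢j , fi≡fj with () ← i≢j (inj fi≡fj)

-- A surjective self-map of Fin n is injective: a section s of f is
-- injective, hence surjective, so every point is of the form s w.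
surjective⇒injective : ∀ {n} (f : Fin n → Fin n) → (∀ w → ∃[ v ] (f v ≡ w)) →
                       Injective _≡_ _≡_ f
surjective⇒injective {n} f surj {a} {b} fa≡fb = begin
    a                 ≡⟨ sym (s-onto a) ⟩
    s (f a)           ≡⟨ cong s fa≡fb ⟩
    s (f b)           ≡⟨ s-onto b ⟩
    b                 ∎
  where
  open ≡-Reasoning
  s : Fin n → Fin n
  s w = proj₁ (surj w)
  s-inj : Injective _≡_ _≡_ s
  s-inj {u} {w} su≡sw =
    trans (sym (proj₂ (surj u))) (trans (cong f su≡sw) (proj₂ (surj w)))
  -- every a is s w for some w, and then s (f a) = s (f (s w)) = s w = a
  s-onto : ∀ a → s (f a) ≡ a
  s-onto a with injective⇒surjective s s-inj a
  ... | w , refl = cong s (proj₂ (surj w))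

¬miss⇒surjective : ∀ {n} (f : Fin n → Fin n) → ¬ (∃[ w ] (∀ v → f v ≢ w)) →
                   ∀ w → ∃[ v ] (f v ≡ w)
¬miss⇒surjective {n} f ¬missed w
  with ¬∀⟶∃¬ n _ (λ v → ¬? (f v ≟ w)) (λ miss → ¬missed (w , miss))
... | v , ¬fv≢w = v , decidable-stable (f v ≟ w) ¬fv≢w

collision⇒miss : ∀ {n} (f : Fin n → Fin n) (i j : Fin n) → i ≢ j → f i ≡ f j →
                 ∃[ w ] (∀ v → f v ≢ w)
collision⇒miss f i j i≢j fi≡fj with any? (λ w → all? (λ v → ¬? (f v ≟ w)))
... | yes missed = missed
... | no ¬missed
  with () ← i≢j (surjective⇒injective f (¬miss⇒surjective f ¬missed) fi≡fj)

⟨⟩-least : ∀ {n} {A B : PermSet n} → A ⊆ₚ ⟨ B ⟩ → ⟨ A ⟩ ⊆ₚ ⟨ B ⟩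
⟨⟩-least A⊆ σ (gen a)    = A⊆ σ a
⟨⟩-least A⊆ _ one        = one
⟨⟩-least A⊆ _ (mul a b)  = mul (⟨⟩-least A⊆ _ a) (⟨⟩-least A⊆ _ b)
⟨⟩-least A⊆ _ (inv a)    = inv (⟨⟩-least A⊆ _ a)
⟨⟩-least A⊆ _ (resp e a) = resp e (⟨⟩-least A⊆ _ a)

_^_ : ∀ {n} → Permutation′ n → Permutation′ n → Permutation′ n
k ^ m = flip m ∘ₚ k ∘ₚ m

^-fix : ∀ {n} (k m : Permutation′ n) {p} → k ⟨$⟩ʳ p ≡ p →
        (k ^ m) ⟨$⟩ʳ (m ⟨$⟩ʳ p) ≡ m ⟨$⟩ʳ p
^-fix k m {p} kp≡p = begin
    m ⟨$⟩ʳ (k ⟨$⟩ʳ (m ⟨$⟩ˡ (m ⟨$⟩ʳ p)))  ≡⟨ cong (λ q → m ⟨$⟩ʳ (k ⟨$⟩ʳ q)) (inverseˡ m) ⟩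
    m ⟨$⟩ʳ (k ⟨$⟩ʳ p)                    ≡⟨ cong (m ⟨$⟩ʳ_) kp≡p ⟩
    m ⟨$⟩ʳ p                             ∎
  where open ≡-Reasoning

^-cancel : ∀ {n} (k m : Permutation′ n) → (m ∘ₚ (k ^ m) ∘ₚ flip m) ≈ k
^-cancel k m p = begin
    m ⟨$⟩ˡ (m ⟨$⟩ʳ (k ⟨$⟩ʳ (m ⟨$⟩ˡ (m ⟨$⟩ʳ p))))  ≡⟨ inverseˡ m ⟩
    k ⟨$⟩ʳ (m ⟨$⟩ˡ (m ⟨$⟩ʳ p))                    ≡⟨ cong (k ⟨$⟩ʳ_) (inverseˡ m) ⟩
    k ⟨$⟩ʳ p                                     ∎
  where open ≡-Reasoning

∘-flip-cancel : ∀ {n} (k μ : Permutation′ n) → ((k ∘ₚ μ) ∘ₚ flip μ) ≈ k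
∘-flip-cancel k μ p = inverseˡ μ

module Regular {n : ℕ} (N : PermSet n) (N-group : IsPermGroup N)
               (N-regular : IsRegular N) (x : Fin n) where

  module N = IsPermGroup N-group

  transitive : ∀ (a b : Fin n) → ∃[ ν ] (N ν × ν ⟨$⟩ʳ a ≡ b)
  transitive = proj₁ N-regular

  semiregular : ∀ ν (a : Fin n) → N ν → ν ⟨$⟩ʳ a ≡ a → ν ≈ id
  semiregular = proj₂ N-regular

  agree⇒≈ : ∀ {μ ν} (a : Fin n) → N μ → N ν → μ ⟨$⟩ʳ a ≡ ν ⟨$⟩ʳ a → μ ≈ ν
  agree⇒≈ {μ} {ν} a Nμ Nν μa≡νa b = begin
      μ ⟨$⟩ʳ b                      ≡⟨ sym (inverseʳ ν) ⟩
      ν ⟨$⟩ʳ (ν ⟨$⟩ˡ (μ ⟨$⟩ʳ b))    ≡⟨ cong (ν ⟨$⟩ʳ_) (μν⁻¹≈id b) ⟩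
      ν ⟨$⟩ʳ b                      ∎
    where
    open ≡-Reasoning
    μν⁻¹≈id : (μ ∘ₚ flip ν) ≈ id
    μν⁻¹≈id = semiregular _ a (N.comp Nμ (N.inv Nν))
                (trans (cong (ν ⟨$⟩ˡ_) μa≡νa) (inverseˡ ν))

  moves-x⇒derangement : ∀ {ν} → N ν → ν ⟨$⟩ʳ x ≢ x → ∀ p → ν ⟨$⟩ʳ p ≢ p
  moves-x⇒derangement Nν νx≢x p νp≡p = νx≢x (semiregular _ p Nν νp≡p x)

  δ : Permutation′ n → Fin n → Permutation′ n
  δ g v = proj₁ (transitive (g ⟨$⟩ʳ v) v)

  δ∈N : ∀ g v → N (δ g v)
  δ∈N g v = proj₁ (proj₂ (transitive (g ⟨$⟩ʳ v) v))

  δ-back : ∀ g v → δ g v ⟨$⟩ʳ (g ⟨$⟩ʳ v) ≡ v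
  δ-back g v = proj₂ (proj₂ (transitive (g ⟨$⟩ʳ v) v))

  disp : Permutation′ n → Fin n → Fin n
  disp g v = δ g v ⟨$⟩ʳ x

  fixes⇒disp : ∀ g {μ} v → N μ → (g ∘ₚ μ) ⟨$⟩ʳ v ≡ v → μ ⟨$⟩ʳ x ≡ disp g v
  fixes⇒disp g v Nμ gμv≡v =
    agree⇒≈ (g ⟨$⟩ʳ v) Nμ (δ∈N g v) (trans gμv≡v (sym (δ-back g v))) x

  disp⇒fixes : ∀ g {μ} v → N μ → μ ⟨$⟩ʳ x ≡ disp g v → (g ∘ₚ μ) ⟨$⟩ʳ v ≡ v
  disp⇒fixes g v Nμ μx≡disp =
    trans (agree⇒≈ x Nμ (δ∈N g v) μx≡disp (g ⟨$⟩ʳ v)) (δ-back g v)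

  fixes⇒disp-x : ∀ g v → g ⟨$⟩ʳ v ≡ v → disp g v ≡ x
  fixes⇒disp-x g v gv≡v = sym (fixes⇒disp g v N.has-id gv≡v)

  disp-x⇒fixes : ∀ g v → disp g v ≡ x → g ⟨$⟩ʳ v ≡ v
  disp-x⇒fixes g v disp≡x = disp⇒fixes g v N.has-id (sym disp≡x)

  disp-miss⇒derangement : ∀ g {μ} → N μ → (∀ v → disp g v ≢ μ ⟨$⟩ʳ x) →
                          ∀ v → (g ∘ₚ μ) ⟨$⟩ʳ v ≢ v
  disp-miss⇒derangement g Nμ miss v gμv≡v = miss v (sym (fixes⇒disp g v Nμ gμv≡v))

  collision⇒two-fixed : ∀ g {i j} → disp g i ≡ disp g j →
                        (g ∘ₚ δ g i) ⟨$⟩ʳ i ≡ i × (g ∘ₚ δ g i) ⟨$⟩ʳ j ≡ j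
  collision⇒two-fixed g {i} {j} collide =
    δ-back g i , disp⇒fixes g j (δ∈N g i) collide

module Derangements {n : ℕ} (G N : PermSet n) (G-group : IsPermGroup G)
                    (N-group : IsPermGroup N) (N⊆G : N ⊆ₚ G)
                    (N-regular : IsRegular N) (x : Fin n) where

  open Regular N N-group N-regular x
  module G = IsPermGroup G-group

  S : PermSet n
  S σ = N σ ⊎ (∃[ y ] (y ≢ x × Stab₂ G x y σ))

  -- Every element of G fixing two distinct points lies in ⟨S⟩:
  -- conjugate by m ∈ N with m(i) = x to land in H_{m(j)}.
  two-fixed⊆⟨S⟩ : ∀ {k i j} → i ≢ j → G k → k ⟨$⟩ʳ i ≡ i → k ⟨$⟩ʳ j ≡ j →
                  ⟨ S ⟩ k
  two-fixed⊆⟨S⟩ {k} {i} {j} i≢j Gk ki≡i kj≡j =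
    resp (^-cancel k m)
      (mul (gen (inj₁ Nm))
        (mul (gen (inj₂ (m ⟨$⟩ʳ j , mj≢x , Gc , cx≡x , ^-fix k m kj≡j)))
             (inv (gen (inj₁ Nm)))))
    where
    m : Permutation′ n
    m = proj₁ (transitive i x)
    Nm : N m
    Nm = proj₁ (proj₂ (transitive i x))
    mi≡x : m ⟨$⟩ʳ i ≡ x
    mi≡x = proj₂ (proj₂ (transitive i x))
    Gc : G (k ^ m)
    Gc = G.comp (G.inv (N⊆G m Nm)) (G.comp Gk (N⊆G m Nm))
    cx≡x : (k ^ m) ⟨$⟩ʳ x ≡ x
    cx≡x = subst (λ q → (k ^ m) ⟨$⟩ʳ q ≡ q) mi≡x (^-fix k m ki≡i)
    mj≢x : m ⟨$⟩ʳ j ≢ x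
    mj≢x mj≡x = i≢j (trans (sym (inverseˡ m))
                      (trans (cong (m ⟨$⟩ˡ_) (trans mi≡x (sym mj≡x))) (inverseˡ m)))

  -- Der_G ⊆ ⟨S⟩: write a derangement g as (g δ) δ⁻¹ with g δ ∈ G fixing
  -- two points, found from a collision of disp g.
  Der⊆⟨S⟩ : Der G ⊆ₚ ⟨ S ⟩
  Der⊆⟨S⟩ g (Gg , g-der)
    with miss⇒collision (disp g) x (λ v disp≡x → g-der v (disp-x⇒fixes g v disp≡x))
  ... | i , j , i≢j , collide =
    resp (∘-flip-cancel g μ)
      (mul (two-fixed⊆⟨S⟩ i≢j (G.comp Gg (N⊆G μ Nμ)) fix-i fix-j)
           (inv (gen (inj₁ Nμ))))
    where
    μ : Permutation′ n
    μ = δ g i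
    Nμ : N μ
    Nμ = δ∈N g i
    fix-i : (g ∘ₚ μ) ⟨$⟩ʳ i ≡ i
    fix-i = proj₁ (collision⇒two-fixed g collide)
    fix-j : (g ∘ₚ μ) ⟨$⟩ʳ j ≡ j
    fix-j = proj₂ (collision⇒two-fixed g collide)

  -- S ⊆ ⟨Der_G⟩: an element of N is trivial or a derangement; an element h
  -- of H_y is (h ν) ν⁻¹ with h ν and ν derangements, ν(x) missed by disp h.
  S⊆⟨Der⟩ : S ⊆ₚ ⟨ Der G ⟩
  S⊆⟨Der⟩ ν (inj₁ Nν) with ν ⟨$⟩ʳ x ≟ x
  ... | yes νx≡x = resp (λ p → sym (semiregular ν x Nν νx≡x p)) one
  ... | no νx≢x = gen (N⊆G ν Nν , moves-x⇒derangement Nν νx≢x)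
  S⊆⟨Der⟩ h (inj₂ (y , y≢x , Gh , hx≡x , hy≡y))
    with collision⇒miss (disp h) x y (λ x≡y → y≢x (sym x≡y))
           (trans (fixes⇒disp-x h x hx≡x) (sym (fixes⇒disp-x h y hy≡y)))
  ... | w , miss =
    resp (∘-flip-cancel h ν)
      (mul (gen (G.comp Gh (N⊆G ν Nν) , hν-der)) (inv (gen (N⊆G ν Nν , ν-der))))
    where
    ν : Permutation′ n
    ν = proj₁ (transitive x w)
    Nν : N ν
    Nν = proj₁ (proj₂ (transitive x w))
    νx≡w : ν ⟨$⟩ʳ x ≡ w
    νx≡w = proj₂ (proj₂ (transitive x w))
    hν-der : ∀ v → (h ∘ₚ ν) ⟨$⟩ʳ v ≢ v
    hν-der = disp-miss⇒derangement h Nν (λ v disp≡νx → miss v (trans disp≡νx νx≡w))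
    -- w ≠ x because x = disp h x is hit
    ν-der : ∀ p → ν ⟨$⟩ʳ p ≢ p
    ν-der = moves-x⇒derangement Nν
              (λ νx≡x → miss x (trans (fixes⇒disp-x h x hx≡x) (trans (sym νx≡x) νx≡w)))

-- Theorem 5.5: ⟨Der_G⟩ = ⟨N, H_y (y ≠ x)⟩.
theorem5p5 : ∀ (n : ℕ) (G N : PermSet n) →
    IsPermGroup G → TwoTransitive G →
    IsNormalSubgroup N G → IsRegular N →
    (x : Fin n) →
    ⟨ Der G ⟩ ≐ ⟨ (λ σ → N σ ⊎ (∃[ y ] (y ≢ x × Stab₂ G x y σ))) ⟩
theorem5p5 n G N G-group _ (N-group , N⊆G , _) N-regular x =
  ⟨⟩-least Der⊆⟨S⟩ , ⟨⟩-least S⊆⟨Der⟩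
  where open Derangements G N G-group N-group N⊆G N-regular x
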